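{- Let $p$ be a prime and let $R$ be a finite field of order $\ell^m$ with $\ell\neq p$ prime, such that $-1\in (R^{\times})^p$, and assume $G_R(p)$ is connected. Then the following are equivalent: (1) $p\nmid \ell^m-1$; (2) $(R^{\times})^p=R^{\times}=R\setminus\{0\}$; (3) $G_R(p)=K_{\ell^m}$; (4) $G_R(p)$ is not anticonnected.
   Context: $(R^{\times})^p=\{u^p:u\in R^{\times}\}$, assumed to contain $-1$. $G_R(p)$ is the simple undirected graph with vertex set $R$ in which $a,b$ are adjacent iff $a-b\in (R^{\times})^p$. $K_n$ is the complete graph on $n$ vertices. A graph is anticonnected if its complement is connected. -}

module Defs where

open import Level using (Level; _⊔_)
open import Data.Nat using (ℕ)
open import Data.Fin using (Fin)
open import Data.Product using (Σ; _×_; ∃)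
open import Relation.Nullary using (¬_)
open import Relation.Binary.PropositionalEquality as ≡ using ()
open import Relation.Binary.Construct.Closure.ReflexiveTransitive using (Star)
open import Function.Bundles using (Inverse)
open import Algebra.Bundles using (CommutativeRing; Semiring)
import Algebra.Definitions.RawSemiring as RS

module _ {c ℓ : Level} (R : CommutativeRing c ℓ) where
  open CommutativeRing R
  open RS (Semiring.rawSemiring semiring) using (_^_)

  IsField : Set (c ⊔ ℓ)
  IsField = ¬ (0# ≈ 1#) × (∀ x → ¬ (x ≈ 0#) → ∃ λ y → x * y ≈ 1#)

  HasOrder : ℕ → Set (c ⊔ ℓ)
  HasOrder q = Inverse setoid (≡.setoid (Fin q))

  IsUnit : Carrier → Set (c ⊔ ℓ)
  IsUnit u = ∃ λ v → u * v ≈ 1#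

  IsUnitPow : ℕ → Carrier → Set (c ⊔ ℓ)
  IsUnitPow p x = ∃ λ u → IsUnit u × (u ^ p) ≈ x

  -- adjacency in G_R(p): a ≠ b and a - b ∈ (R^×)^p  (simple graph, no loops)
  Adj : ℕ → Carrier → Carrier → Set (c ⊔ ℓ)
  Adj p a b = ¬ (a ≈ b) × IsUnitPow p (a - b)

  CoAdj : ℕ → Carrier → Carrier → Set (c ⊔ ℓ)
  CoAdj p a b = ¬ (a ≈ b) × ¬ Adj p a b

  Connected : (Carrier → Carrier → Set (c ⊔ ℓ)) → Set (c ⊔ ℓ)
  Connected E = ∀ a b → Star E a b

  GConnected : ℕ → Set (c ⊔ ℓ)
  GConnected p = Connected (Adj p)

  GAnticonnected : ℕ → Set (c ⊔ ℓ)
  GAnticonnected p = Connected (CoAdj p)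

  -- G_R(p) is the complete graph on its vertex set R (|R| = q is given separately)
  GComplete : ℕ → Set (c ⊔ ℓ)
  GComplete p = ∀ a b → ¬ (a ≈ b) → Adj p a b

{-# OPTIONS --safe #-}
-- Write |R| = k + 1. Multiplication by a nonzero x permutes the nonzero elements, so x ^ k = 1.
-- If p ∤ k, a Bézout relation x p = 1 + y k (or x p + 1 = y k) writes every unit as a p-th power,
-- so G_R(p) is complete and its complement has no edges. If k = p j, the polynomial X ^ j - 1
-- has at most j < k roots, so some unit a has a ^ j ≠ 1 and is not a p-th power. Then a - 0 is
-- not a p-th power, so G_R(p) is not complete, and multiplication by a maps every walk of G_R(p)
-- to a walk of its complement, which is therefore connected.
module Submission where

open import Defs
open import Level using (Level)
open import Data.Nat using (ℕ; _∸_)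
open import Data.Nat.Divisibility using (_∣_)
open import Data.Nat.Primality using (Prime)
open import Data.Product using (_×_)
open import Relation.Nullary using (¬_)
open import Relation.Binary.PropositionalEquality using (_≡_)
open import Function.Bundles using (_⇔_)
open import Algebra.Bundles using (CommutativeRing)

import Data.Nat as ℕ
import Data.Nat.Properties as ℕ
open import Data.Nat using (zero; suc; _≤_; _<_; z≤n; s≤s; nonTrivial⇒n>1)
open import Data.Nat.Divisibility using (divides)
open import Data.Nat.Primality using (prime⇒irreducible; prime⇒nonTrivial)
open import Data.Nat.Coprimality using (Coprime; coprime-Bézout)
open import Data.Nat.GCD using (module Bézout)
open import Data.Fin using (Fin; zero; suc; punchIn; punchOut)
import Data.Fin.Properties as Fin
open import Data.Fin.Permutation using (Permutation; permutation)
open import Data.Vec using (Vec; []; _∷_; replicate)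
open import Data.Product using (_,_; proj₁; proj₂; ∃)
open import Data.Sum using (inj₁; inj₂)
open import Relation.Nullary using (contradiction; map′)
open import Relation.Binary.Definitions using (Decidable)
import Relation.Binary.PropositionalEquality as ≡
open import Relation.Binary.Construct.Closure.ReflexiveTransitive using (Star; ε; _◅_; _◅◅_; gmap)
open import Function.Base using (_∘_)
open import Function.Bundles using (Inverse; Injection; Equivalence; mk⇔)
open import Function.Properties.Inverse using (Inverse⇒Injection)
open import Algebra.Bundles using (Semiring)
import Algebra.Definitions.RawSemiring as RawSemiring

prime∤⇒coprime : ∀ {p n} → Prime p → ¬ p ∣ n → Coprime p n
prime∤⇒coprime p-prime p∤n (d∣p , d∣n) with prime⇒irreducible p-prime d∣p
... | inj₁ d≡1 = d≡1
... | inj₂ ≡.refl = contradiction d∣n p∤n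

prime⇒1< : ∀ {p} → Prime p → 1 < p
prime⇒1< {p} p-prime = nonTrivial⇒n>1 p {{prime⇒nonTrivial p-prime}}

module UnitPowers {c ℓ} (R : CommutativeRing c ℓ) where
  open CommutativeRing R hiding (zero)
  open RawSemiring (Semiring.rawSemiring semiring) using (_^_)
  open import Algebra.Properties.Semiring.Exp semiring using (^-congˡ; ^-assocʳ)
  open import Algebra.Properties.CommutativeSemiring.Exp commutativeSemiring using (^-distrib-*)
  open import Algebra.Properties.CommutativeSemigroup *-commutativeSemigroup using (interchange)
  open import Relation.Binary.Reasoning.Setoid setoid

  1#^n≈1# : ∀ n → 1# ^ n ≈ 1#
  1#^n≈1# zero    = refl
  1#^n≈1# (suc n) = trans (*-identityˡ _) (1#^n≈1# n)

  isUnit-resp : ∀ {x y} → x ≈ y → IsUnit R x → IsUnit R y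
  isUnit-resp x≈y (v , xv≈1) = v , trans (*-congʳ (sym x≈y)) xv≈1

  isUnit-* : ∀ {x y} → IsUnit R x → IsUnit R y → IsUnit R (x * y)
  isUnit-* {x} {y} (v , xv≈1) (w , yw≈1) = v * w , (begin
    (x * y) * (v * w) ≈⟨ interchange x y v w ⟩
    (x * v) * (y * w) ≈⟨ *-cong xv≈1 yw≈1 ⟩
    1# * 1#           ≈⟨ *-identityˡ 1# ⟩
    1#                ∎)

  isUnit-^ : ∀ {x} → IsUnit R x → ∀ n → IsUnit R (x ^ n)
  isUnit-^ x-unit zero    = 1# , *-identityˡ 1#
  isUnit-^ x-unit (suc n) = isUnit-* x-unit (isUnit-^ x-unit n)

  isUnitPow-resp : ∀ {p x y} → x ≈ y → IsUnitPow R p x → IsUnitPow R p y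
  isUnitPow-resp x≈y (u , u-unit , uᵖ≈x) = u , u-unit , trans uᵖ≈x x≈y

  isUnitPow⇒isUnit : ∀ {p x} → IsUnitPow R p x → IsUnit R x
  isUnitPow⇒isUnit {p} (u , u-unit , uᵖ≈x) = isUnit-resp uᵖ≈x (isUnit-^ u-unit p)

  isUnitPow-* : ∀ {p x y} → IsUnitPow R p x → IsUnitPow R p y → IsUnitPow R p (x * y)
  isUnitPow-* {p} (u , u-unit , uᵖ≈x) (w , w-unit , wᵖ≈y) =
    u * w , isUnit-* u-unit w-unit , trans (^-distrib-* u w p) (*-cong uᵖ≈x wᵖ≈y)

  isUnitPow-inverse : ∀ {p y} → IsUnitPow R p y → ∃ λ z → IsUnitPow R p z × y * z ≈ 1#
  isUnitPow-inverse {p} {y} (u , (v , uv≈1) , uᵖ≈y) = v ^ p , vᵖ-pow , (begin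
    y * v ^ p     ≈⟨ *-congʳ (sym uᵖ≈y) ⟩
    u ^ p * v ^ p ≈⟨ ^-distrib-* u v p ⟨
    (u * v) ^ p   ≈⟨ ^-congˡ p uv≈1 ⟩
    1# ^ p        ≈⟨ 1#^n≈1# p ⟩
    1#            ∎)
    where
    vᵖ-pow : IsUnitPow R p (v ^ p)
    vᵖ-pow = v , (u , trans (*-comm v u) uv≈1) , refl

  ¬isUnitPow-* : ∀ {p x y} → ¬ IsUnitPow R p x → IsUnitPow R p y → ¬ IsUnitPow R p (x * y)
  ¬isUnitPow-* {p} {x} {y} x-nonPow y-pow xy-pow with isUnitPow-inverse {p} y-pow
  ... | z , z-pow , yz≈1 = x-nonPow (isUnitPow-resp {p} xyz≈x (isUnitPow-* {p} xy-pow z-pow))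
    where
    xyz≈x : (x * y) * z ≈ x
    xyz≈x = begin
      (x * y) * z ≈⟨ *-assoc x y z ⟩
      x * (y * z) ≈⟨ *-congˡ yz≈1 ⟩
      x * 1#      ≈⟨ *-identityʳ x ⟩
      x           ∎

  module _ {k} (unit^k≈1 : ∀ {x} → IsUnit R x → x ^ k ≈ 1#) where

    unit^[n*k]≈1 : ∀ {x} → IsUnit R x → ∀ n → x ^ (n ℕ.* k) ≈ 1#
    unit^[n*k]≈1 {x} x-unit n = begin
      x ^ (n ℕ.* k) ≡⟨ ≡.cong (x ^_) (ℕ.*-comm n k) ⟩
      x ^ (k ℕ.* n) ≈⟨ ^-assocʳ x k n ⟨
      (x ^ k) ^ n   ≈⟨ ^-congˡ n (unit^k≈1 x-unit) ⟩
      1# ^ n        ≈⟨ 1#^n≈1# n ⟩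
      1#            ∎

    coprime⇒isUnitPow : ∀ {p a} → Coprime p k → IsUnit R a → IsUnitPow R p a
    coprime⇒isUnitPow {p} {a} p⊥k a-unit@(b , ab≈1) with coprime-Bézout p⊥k
    ... | Bézout.+- x y 1+y*k≡x*p = a ^ x , isUnit-^ a-unit x , (begin
      (a ^ x) ^ p       ≈⟨ ^-assocʳ a x p ⟩
      a ^ (x ℕ.* p)     ≡⟨ ≡.cong (a ^_) 1+y*k≡x*p ⟨
      a * a ^ (y ℕ.* k) ≈⟨ *-congˡ (unit^[n*k]≈1 a-unit y) ⟩
      a * 1#            ≈⟨ *-identityʳ a ⟩
      a                 ∎)
    ... | Bézout.-+ x y 1+x*p≡y*k = b ^ x , isUnit-^ b-unit x , (begin
      (b ^ x) ^ p              ≈⟨ *-identityˡ _ ⟨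
      1# * (b ^ x) ^ p         ≈⟨ *-congʳ ab≈1 ⟨
      (a * b) * (b ^ x) ^ p    ≈⟨ *-assoc a b _ ⟩
      a * (b * (b ^ x) ^ p)    ≈⟨ *-congˡ (*-congˡ (^-assocʳ b x p)) ⟩
      a * b ^ suc (x ℕ.* p)    ≡⟨ ≡.cong (λ n → a * b ^ n) 1+x*p≡y*k ⟩
      a * b ^ (y ℕ.* k)        ≈⟨ *-congˡ (unit^[n*k]≈1 b-unit y) ⟩
      a * 1#                   ≈⟨ *-identityʳ a ⟩
      a                        ∎)
      where
      b-unit : IsUnit R b
      b-unit = a , trans (*-comm b a) ab≈1

module MonicPolynomial {c ℓ} (R : CommutativeRing c ℓ) where
  open CommutativeRing R hiding (zero)
  open RawSemiring (Semiring.rawSemiring semiring) using (_^_)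
  open import Algebra.Properties.AbelianGroup +-abelianGroup using (//-rightDividesˡ)
  open import Algebra.Solver.Ring.NaturalCoefficients.Default commutativeSemiring
  open import Relation.Binary.Reasoning.Setoid setoid

  -- A vector [a₀, …, a_{d-1}] stands for the monic polynomial a₀ + a₁X + ⋯ + a_{d-1}X^(d-1) + X^d.
  eval : ∀ {d} → Vec Carrier d → Carrier → Carrier
  eval []       y = 1#
  eval (a ∷ as) y = a + y * eval as y

  quotient : ∀ {d} → Vec Carrier (suc d) → Carrier → Vec Carrier d
  quotient (_ ∷ [])        r = []
  quotient (_ ∷ f@(_ ∷ _)) r = eval f r ∷ quotient f r

  -- Writing y = (y - r) + r turns the division identity into a semiring identity in y - r and r.
  eval-quotient : ∀ {d} (f : Vec Carrier (suc d)) r y →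
                  eval f y ≈ (y - r) * eval (quotient f r) y + eval f r
  eval-quotient (a ∷ []) r y = begin
    a + y * 1#                  ≈⟨ +-congˡ (*-congʳ (//-rightDividesˡ r y)) ⟨
    a + ((y - r) + r) * 1#      ≈⟨ solve 3 (λ a d r → a :+ (d :+ r) :* con 1 := d :* con 1 :+ (a :+ r :* con 1))
                                         refl a (y - r) r ⟩
    (y - r) * 1# + (a + r * 1#) ∎
  eval-quotient (a ∷ f@(_ ∷ _)) r y = begin
    a + y * eval f y
      ≈⟨ +-congˡ (*-cong (sym (//-rightDividesˡ r y)) (eval-quotient f r y)) ⟩
    a + ((y - r) + r) * ((y - r) * q + s)
      ≈⟨ solve 5 (λ a d r q s → a :+ (d :+ r) :* (d :* q :+ s) := d :* (s :+ (d :+ r) :* q) :+ (a :+ r :* s))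
               refl a (y - r) r q s ⟩
    (y - r) * (s + ((y - r) + r) * q) + (a + r * s)
      ≈⟨ +-congʳ (*-congˡ (+-congˡ (*-congʳ (//-rightDividesˡ r y)))) ⟩
    (y - r) * (s + y * q) + (a + r * s)
      ∎
    where
    q = eval (quotient f r) y
    s = eval f r

  factor-theorem : ∀ {d} (f : Vec Carrier (suc d)) {r} y → eval f r ≈ 0# →
                   eval f y ≈ (y - r) * eval (quotient f r) y
  factor-theorem f {r} y fr≈0 = begin
    eval f y                                   ≈⟨ eval-quotient f r y ⟩
    (y - r) * eval (quotient f r) y + eval f r ≈⟨ +-congˡ fr≈0 ⟩
    (y - r) * eval (quotient f r) y + 0#       ≈⟨ +-identityʳ _ ⟩
    (y - r) * eval (quotient f r) y            ∎

  X^[1+_]-1 : ∀ n → Vec Carrier (suc n)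
  X^[1+ n ]-1 = - 1# ∷ replicate n 0#

  eval-X^[1+n]-1 : ∀ n y → eval X^[1+ n ]-1 y ≈ - 1# + y ^ suc n
  eval-X^[1+n]-1 n y = +-congˡ (*-congˡ (eval-Xⁿ n))
    where
    eval-Xⁿ : ∀ n → eval (replicate n 0#) y ≈ y ^ n
    eval-Xⁿ zero    = refl
    eval-Xⁿ (suc n) = trans (+-identityˡ _) (*-congˡ (eval-Xⁿ n))

module FieldProperties {c ℓ} (R : CommutativeRing c ℓ) (isField : IsField R) where
  open CommutativeRing R hiding (zero)
  open UnitPowers R
  open MonicPolynomial R
  open import Algebra.Properties.Ring ring using (x[y-z]≈xy-xz; -1*x≈-x)
  open import Algebra.Properties.AbelianGroup +-abelianGroup
    using (x∙y⁻¹≈ε⇒x≈y; x≈y⇒x∙y⁻¹≈ε; ε⁻¹≈ε; ⁻¹-anti-homo‿-; xyx⁻¹≈y; //-rightDividesˡ)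
  open import Relation.Binary.Reasoning.Setoid setoid

  0≉1 : ¬ 0# ≈ 1#
  0≉1 = proj₁ isField

  ≉0⇒isUnit : ∀ {x} → ¬ x ≈ 0# → IsUnit R x
  ≉0⇒isUnit = proj₂ isField _

  isUnit⇒≉0 : ∀ {x} → IsUnit R x → ¬ x ≈ 0#
  isUnit⇒≉0 {x} (y , xy≈1) x≈0 = 0≉1 (begin
    0#     ≈⟨ zeroˡ y ⟨
    0# * y ≈⟨ *-congʳ x≈0 ⟨
    x * y  ≈⟨ xy≈1 ⟩
    1#     ∎)

  *-≉0 : ∀ {x y} → ¬ x ≈ 0# → ¬ y ≈ 0# → ¬ x * y ≈ 0#
  *-≉0 x≉0 y≉0 = isUnit⇒≉0 (isUnit-* (≉0⇒isUnit x≉0) (≉0⇒isUnit y≉0))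

  ≉0∧*≈0⇒≈0 : ∀ {x y} → ¬ x ≈ 0# → x * y ≈ 0# → y ≈ 0#
  ≉0∧*≈0⇒≈0 {x} {y} x≉0 xy≈0 with ≉0⇒isUnit x≉0
  ... | v , xv≈1 = begin
    y            ≈⟨ *-identityˡ y ⟨
    1# * y       ≈⟨ *-congʳ (trans (sym xv≈1) (*-comm x v)) ⟩
    (v * x) * y  ≈⟨ *-assoc v x y ⟩
    v * (x * y)  ≈⟨ *-congˡ xy≈0 ⟩
    v * 0#       ≈⟨ zeroʳ v ⟩
    0#           ∎

  *-cancelˡ-≉0 : ∀ {x y z} → ¬ x ≈ 0# → x * y ≈ x * z → y ≈ z
  *-cancelˡ-≉0 {x} {y} {z} x≉0 xy≈xz =
    x∙y⁻¹≈ε⇒x≈y y z (≉0∧*≈0⇒≈0 x≉0 (trans (x[y-z]≈xy-xz x y z) (x≈y⇒x∙y⁻¹≈ε xy≈xz)))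

  ≉⇒-≉0 : ∀ {x y} → ¬ x ≈ y → ¬ x - y ≈ 0#
  ≉⇒-≉0 {x} {y} x≉y = x≉y ∘ x∙y⁻¹≈ε⇒x≈y x y

  x-0≈x : ∀ x → x - 0# ≈ x
  x-0≈x x = trans (+-congˡ ε⁻¹≈ε) (+-identityʳ x)

  roots≤degree : ∀ {d n} (f : Vec Carrier d) (r : Fin n → Carrier) →
                 (∀ i j → r i ≈ r j → i ≡ j) → (∀ i → eval f (r i) ≈ 0#) → n ≤ d
  roots≤degree {n = zero}  f  r r-injective roots = z≤n
  roots≤degree {n = suc n} [] r r-injective roots = contradiction (sym (roots zero)) 0≉1
  roots≤degree {n = suc n} f@(_ ∷ _) r r-injective roots =
    s≤s (roots≤degree (quotient f (r zero)) (r ∘ suc) r∘suc-injective quotient-roots)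
    where
    r∘suc-injective : ∀ i j → r (suc i) ≈ r (suc j) → i ≡ j
    r∘suc-injective i j rᵢ≈rⱼ = Fin.suc-injective (r-injective (suc i) (suc j) rᵢ≈rⱼ)
    quotient-roots : ∀ i → eval (quotient f (r zero)) (r (suc i)) ≈ 0#
    quotient-roots i =
      ≉0∧*≈0⇒≈0 rᵢ-r₀≉0 (trans (sym (factor-theorem f (r (suc i)) (roots zero))) (roots (suc i)))
      where
      rᵢ-r₀≉0 : ¬ r (suc i) - r zero ≈ 0#
      rᵢ-r₀≉0 = ≉⇒-≉0 (λ rᵢ≈r₀ → Fin.0≢1+n (≡.sym (r-injective (suc i) zero rᵢ≈r₀)))

  coAdj : ∀ {p a b c} → a - b ≈ c → ¬ c ≈ 0# → ¬ IsUnitPow R p c → CoAdj R p a b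
  coAdj {p} a-b≈c c≉0 c-nonPow =
      (λ a≈b → c≉0 (trans (sym a-b≈c) (x≈y⇒x∙y⁻¹≈ε a≈b)))
    , (c-nonPow ∘ isUnitPow-resp {p} a-b≈c ∘ proj₂)

  complete∧coWalk⇒≈ : ∀ {p a b} → GComplete R p → Star (CoAdj R p) a b → a ≈ b
  complete∧coWalk⇒≈ complete ε                    = refl
  complete∧coWalk⇒≈ complete ((a≉b , ¬adj) ◅ _) = contradiction (complete _ _ a≉b) ¬adj

  complete⇒¬anticonnected : ∀ {p} → GComplete R p → ¬ GAnticonnected R p
  complete⇒¬anticonnected {p} complete anticonnected =
    0≉1 (complete∧coWalk⇒≈ {p} complete (anticonnected 0# 1#))

  module _ {p n} (-1-pow : IsUnitPow R p (- 1#)) (n-unit : IsUnit R n) (n-nonPow : ¬ IsUnitPow R p n) where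

    n*-Adj⇒CoAdj : ∀ {x y} → Adj R p x y → CoAdj R p (n * x) (n * y)
    n*-Adj⇒CoAdj {x} {y} (x≉y , x-y-pow) = coAdj {p} (sym (x[y-z]≈xy-xz n x y))
      (*-≉0 (isUnit⇒≉0 n-unit) (≉⇒-≉0 x≉y)) (¬isUnitPow-* {p} n-nonPow x-y-pow)

    -- Star demands literally equal endpoints; a ≈ a' are joined by the closed co-walk a, a - n, a'.
    ≈⇒coWalk : ∀ {a a'} → a ≈ a' → Star (CoAdj R p) a a'
    ≈⇒coWalk {a} {a'} a≈a' =
      coAdj {p} a-[a-n]≈n (isUnit⇒≉0 n-unit) n-nonPow ◅
      coAdj {p} [a-n]-a'≈-n (isUnit⇒≉0 -n-unit) -n-nonPow ◅ ε
      where
      a-[a-n]≈n : a - (a - n) ≈ n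
      a-[a-n]≈n = begin
        a - (a - n)   ≈⟨ +-congˡ (⁻¹-anti-homo‿- a n) ⟩
        a + (n - a)   ≈⟨ +-comm a (n - a) ⟩
        (n - a) + a   ≈⟨ //-rightDividesˡ a n ⟩
        n             ∎
      [a-n]-a'≈-n : (a - n) - a' ≈ - n
      [a-n]-a'≈-n = trans (+-congˡ (-‿cong (sym a≈a'))) (xyx⁻¹≈y a (- n))
      -n-unit : IsUnit R (- n)
      -n-unit = isUnit-resp (-1*x≈-x n) (isUnit-* (isUnitPow⇒isUnit {p} -1-pow) n-unit)
      -n-nonPow : ¬ IsUnitPow R p (- n)
      -n-nonPow =
        ¬isUnitPow-* {p} n-nonPow -1-pow ∘ isUnitPow-resp {p} (trans (sym (-1*x≈-x n)) (*-comm (- 1#) n))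

    connected⇒anticonnected : GConnected R p → GAnticonnected R p
    connected⇒anticonnected connected a b =
      ≈⇒coWalk (sym (n*[m*x]≈x a))
        ◅◅ gmap (n *_) n*-Adj⇒CoAdj (connected (m * a) (m * b))
        ◅◅ ≈⇒coWalk (n*[m*x]≈x b)
      where
      m = proj₁ n-unit
      n*[m*x]≈x : ∀ x → n * (m * x) ≈ x
      n*[m*x]≈x x = trans (sym (*-assoc n m x)) (trans (*-congʳ (proj₂ n-unit)) (*-identityˡ x))

module FiniteField {c ℓ} (R : CommutativeRing c ℓ) (isField : IsField R) {k} (order : HasOrder R (suc k)) where
  open CommutativeRing R hiding (zero)
  open RawSemiring (Semiring.rawSemiring semiring) using (_^_)
  open UnitPowers R
  open MonicPolynomial R
  open FieldProperties R isField
  open import Algebra.Properties.Semiring.Exp semiring using (^-congˡ; ^-assocʳ)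
  open import Algebra.Properties.CommutativeMonoid.Sum *-commutativeMonoid
    using (sum-replicate; ∑-distrib-+; ∑-permute; sum-cong-≋)
    renaming (sum to product)
  open import Relation.Binary.Reasoning.Setoid setoid
  open Inverse order using (to; from; to-cong; strictlyInverseˡ; strictlyInverseʳ)

  to-injective : ∀ {x y} → to x ≡ to y → x ≈ y
  to-injective = Injection.injective (Inverse⇒Injection order)

  infix 4 _≟_
  _≟_ : Decidable _≈_
  x ≟ y = map′ to-injective to-cong (to x Fin.≟ to y)

  nonzero : Fin k → Carrier
  nonzero i = from (punchIn (to 0#) i)

  to-nonzero : ∀ i → to (nonzero i) ≡ punchIn (to 0#) i
  to-nonzero i = strictlyInverseˡ _

  nonzero≉0 : ∀ i → ¬ nonzero i ≈ 0#
  nonzero≉0 i nᵢ≈0 = Fin.punchInᵢ≢i (to 0#) i (≡.trans (≡.sym (to-nonzero i)) (to-cong nᵢ≈0))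

  nonzero-injective : ∀ i j → nonzero i ≈ nonzero j → i ≡ j
  nonzero-injective i j nᵢ≈nⱼ =
    Fin.punchIn-injective (to 0#) i j
      (≡.trans (≡.sym (to-nonzero i)) (≡.trans (to-cong nᵢ≈nⱼ) (to-nonzero j)))

  index : ∀ {x} → ¬ x ≈ 0# → Fin k
  index x≉0 = punchOut (x≉0 ∘ to-injective ∘ ≡.sym)

  nonzero-index : ∀ {x} (x≉0 : ¬ x ≈ 0#) → nonzero (index x≉0) ≈ x
  nonzero-index {x} x≉0 = trans (reflexive (≡.cong from (Fin.punchIn-punchOut _))) (strictlyInverseʳ x)

  scale : ∀ {x} → ¬ x ≈ 0# → Fin k → Fin k
  scale x≉0 i = index (*-≉0 x≉0 (nonzero≉0 i))

  nonzero-scale : ∀ {x} (x≉0 : ¬ x ≈ 0#) i → nonzero (scale x≉0 i) ≈ x * nonzero i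
  nonzero-scale x≉0 i = nonzero-index (*-≉0 x≉0 (nonzero≉0 i))

  scale-inverse : ∀ {x y} (x≉0 : ¬ x ≈ 0#) (y≉0 : ¬ y ≈ 0#) → x * y ≈ 1# →
                  ∀ i → scale x≉0 (scale y≉0 i) ≡ i
  scale-inverse {x} {y} x≉0 y≉0 xy≈1 i = nonzero-injective _ _ (begin
    nonzero (scale x≉0 (scale y≉0 i)) ≈⟨ nonzero-scale x≉0 _ ⟩
    x * nonzero (scale y≉0 i)          ≈⟨ *-congˡ (nonzero-scale y≉0 i) ⟩
    x * (y * nonzero i)                ≈⟨ *-assoc x y _ ⟨
    (x * y) * nonzero i                ≈⟨ *-congʳ xy≈1 ⟩
    1# * nonzero i                     ≈⟨ *-identityˡ _ ⟩
    nonzero i                          ∎)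

  scaling : ∀ {x} → ¬ x ≈ 0# → Permutation k k
  scaling {x} x≉0 with ≉0⇒isUnit x≉0
  ... | y , xy≈1 =
    permutation (scale x≉0) (scale y≉0) (scale-inverse x≉0 y≉0 xy≈1) (scale-inverse y≉0 x≉0 yx≈1)
    where
    yx≈1 = trans (*-comm y x) xy≈1
    y≉0 = isUnit⇒≉0 (x , yx≈1)

  product≉0 : ∀ {n} (f : Fin n → Carrier) → (∀ i → ¬ f i ≈ 0#) → ¬ product f ≈ 0#
  product≉0 {zero}  f f≉0 = 0≉1 ∘ sym
  product≉0 {suc n} f f≉0 = *-≉0 (f≉0 zero) (product≉0 (f ∘ suc) (f≉0 ∘ suc))

  ≉0⇒^k≈1 : ∀ {x} → ¬ x ≈ 0# → x ^ k ≈ 1#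
  ≉0⇒^k≈1 {x} x≉0 = *-cancelˡ-≉0 (product≉0 nonzero nonzero≉0) (begin
    P * x ^ k                       ≈⟨ *-comm P _ ⟩
    x ^ k * P                       ≈⟨ *-congʳ (sum-replicate k {x}) ⟨
    product {k} (λ _ → x) * P       ≈⟨ ∑-distrib-+ (λ _ → x) nonzero ⟨
    product (λ i → x * nonzero i)   ≈⟨ sum-cong-≋ (nonzero-scale x≉0) ⟨
    product (nonzero ∘ scale x≉0)   ≈⟨ ∑-permute nonzero (scaling x≉0) ⟨
    P                               ≈⟨ *-identityʳ P ⟨
    P * 1#                          ∎)
    where
    P = product nonzero

  ∃≉0∧^[1+j]≉1 : ∀ j → suc j < k → ∃ λ x → ¬ x ≈ 0# × ¬ x ^ suc j ≈ 1#
  ∃≉0∧^[1+j]≉1 j 1+j<k with Fin.¬∀⟶∃¬ k _ (λ i → nonzero i ^ suc j ≟ 1#) ¬all-roots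
    where
    ¬all-roots : ¬ (∀ i → nonzero i ^ suc j ≈ 1#)
    ¬all-roots all-roots = ℕ.<⇒≱ 1+j<k (roots≤degree X^[1+ j ]-1 nonzero nonzero-injective roots)
      where
      roots : ∀ i → eval X^[1+ j ]-1 (nonzero i) ≈ 0#
      roots i = trans (eval-X^[1+n]-1 j (nonzero i)) (trans (+-congˡ (all-roots i)) (-‿inverseˡ 1#))
  ... | i , nᵢ^[1+j]≉1 = nonzero i , nonzero≉0 i , nᵢ^[1+j]≉1

  ∣⇒∃¬isUnitPow : ∀ {d} → 1 < d → d ∣ k → ∃ λ a → IsUnit R a × ¬ IsUnitPow R d a
  ∣⇒∃¬isUnitPow 1<d (divides zero k≡0) = contradiction (≡.subst Fin k≡0 (index (0≉1 ∘ sym))) Fin.¬Fin0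
  ∣⇒∃¬isUnitPow {d} 1<d (divides (suc j) k≡[1+j]*d) with ∃≉0∧^[1+j]≉1 j 1+j<k
    where
    1+j<k : suc j < k
    1+j<k = ≡.subst (suc j <_) (≡.sym k≡[1+j]*d) (ℕ.m<m*n (suc j) d 1<d)
  ... | a , a≉0 , a^[1+j]≉1 = a , ≉0⇒isUnit a≉0 , a-nonPow
    where
    a-nonPow : ¬ IsUnitPow R d a
    a-nonPow (u , u-unit , uᵈ≈a) = a^[1+j]≉1 (begin
      a ^ suc j          ≈⟨ ^-congˡ (suc j) uᵈ≈a ⟨
      (u ^ d) ^ suc j    ≈⟨ ^-assocʳ u d (suc j) ⟩
      u ^ (d ℕ.* suc j)  ≡⟨ ≡.cong (u ^_) (≡.trans (ℕ.*-comm d (suc j)) (≡.sym k≡[1+j]*d)) ⟩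
      u ^ k              ≈⟨ ≉0⇒^k≈1 (isUnit⇒≉0 u-unit) ⟩
      1#                 ∎)

  module _ {p} (p-prime : Prime p) where

    ∤⇒isUnitPow : ¬ p ∣ k → ∀ {a} → IsUnit R a → IsUnitPow R p a
    ∤⇒isUnitPow p∤k = coprime⇒isUnitPow (≉0⇒^k≈1 ∘ isUnit⇒≉0) (prime∤⇒coprime p-prime p∤k)

    ∤⇒complete : ¬ p ∣ k → GComplete R p
    ∤⇒complete p∤k a b a≉b = a≉b , ∤⇒isUnitPow p∤k (≉0⇒isUnit (≉⇒-≉0 a≉b))

    refutedBy¬isUnitPow⇒∤ : ∀ {a} {A : Set a} →
                            (∀ {x} → IsUnit R x → ¬ IsUnitPow R p x → ¬ A) → A → ¬ p ∣ k
    refutedBy¬isUnitPow⇒∤ refute a p∣k with ∣⇒∃¬isUnitPow (prime⇒1< p-prime) p∣k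
    ... | x , x-unit , x-nonPow = refute x-unit x-nonPow a

    ∤⇔unitsArePowers : (¬ p ∣ k) ⇔
                       ((∀ x → IsUnitPow R p x ⇔ IsUnit R x) × (∀ x → IsUnit R x ⇔ (¬ x ≈ 0#)))
    ∤⇔unitsArePowers = mk⇔
      (λ p∤k → (λ _ → mk⇔ (isUnitPow⇒isUnit {p}) (∤⇒isUnitPow p∤k)) , (λ _ → mk⇔ isUnit⇒≉0 ≉0⇒isUnit))
      (refutedBy¬isUnitPow⇒∤ λ x-unit x-nonPow (powers , _) →
        x-nonPow (Equivalence.from (powers _) x-unit))

    ∤⇔complete : (¬ p ∣ k) ⇔ GComplete R p
    ∤⇔complete = mk⇔ ∤⇒complete (refutedBy¬isUnitPow⇒∤ λ {x} x-unit x-nonPow complete →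
      x-nonPow (isUnitPow-resp {p} (x-0≈x x) (proj₂ (complete x 0# (isUnit⇒≉0 x-unit)))))

    ∤⇔¬anticonnected : IsUnitPow R p (- 1#) → GConnected R p → (¬ p ∣ k) ⇔ (¬ GAnticonnected R p)
    ∤⇔¬anticonnected -1-pow connected = mk⇔ (complete⇒¬anticonnected {p} ∘ ∤⇒complete)
      (refutedBy¬isUnitPow⇒∤ λ x-unit x-nonPow ¬anticonnected →
        ¬anticonnected (connected⇒anticonnected {p} -1-pow x-unit x-nonPow connected))

open import Data.Nat using (_^_)

proposition3p5 : {c ℓ' : Level} (p ℓ m : ℕ) (R : CommutativeRing c ℓ') →
    Prime p → Prime ℓ → ¬ (ℓ ≡ p) →
    IsField R → HasOrder R (ℓ ^ m) →
    IsUnitPow R p (CommutativeRing.-_ R (CommutativeRing.1# R)) →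
    GConnected R p →
    ((¬ (p ∣ ℓ ^ m ∸ 1)) ⇔
        ((∀ x → (IsUnitPow R p x ⇔ IsUnit R x))
          × (∀ x → (IsUnit R x ⇔ (¬ (CommutativeRing._≈_ R x (CommutativeRing.0# R)))))))
    × ((¬ (p ∣ ℓ ^ m ∸ 1)) ⇔ GComplete R p)
    × ((¬ (p ∣ ℓ ^ m ∸ 1)) ⇔ (¬ GAnticonnected R p))
proposition3p5 p ℓ m R p-prime _ _ isField order -1-pow connected with ℓ ^ m | order
... | zero  | order = contradiction (Inverse.to order (CommutativeRing.0# R)) Fin.¬Fin0
... | suc k | order =
  ∤⇔unitsArePowers p-prime , ∤⇔complete p-prime , ∤⇔¬anticonnected p-prime -1-pow connected
  where
  open FiniteField R isField order
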